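{- For every positive integer $r$, $$g^4(C_2^r)\ \ge\ r+\left\lfloor\frac{r}{2}\right\rfloor+\left\lfloor\frac{r-4}{3}\right\rfloor+1.$$
   Context: $C_2^r$ denotes the elementary abelian $2$-group of rank $r$ (the direct sum of $r$ copies of the cyclic group of order 2). For a finite abelian group $G$ (written additively) and a positive integer $k$, the $k$-Harborth constant $g^k(G)$ is the smallest positive integer $t$ such that every subset $S\subseteq G$ with $|S|\ge t$ contains a subset $T$ with $|T|=k$ and $\sum_{x\in T}x=0$. -}

module Defs where

open import Data.Bool using (Bool; false; _xor_)
open import Data.Nat using (ℕ; _≤_; _≥_; _<_)
open import Data.Vec using (Vec; replicate; zipWith)
open import Data.List using (List; length; foldr)
open import Data.List.Relation.Unary.Unique.Propositional using (Unique)
open import Data.List.Relation.Binary.Subset.Propositional using (_⊆_)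
open import Data.Product using (Σ; _×_; ∃-syntax)
open import Relation.Binary.PropositionalEquality using (_≡_)
open import Relation.Nullary using (¬_)

C₂^ : ℕ → Set
C₂^ r = Vec Bool r

0G : ∀ {r} → C₂^ r
0G {r} = replicate r false

_+G_ : ∀ {r} → C₂^ r → C₂^ r → C₂^ r
_+G_ = zipWith _xor_

ΣG : ∀ {r} → List (C₂^ r) → C₂^ r
ΣG {r} = foldr _+G_ 0G

record Subset (r : ℕ) : Set where
  constructor mkSubset
  field
    elems  : List (C₂^ r)
    unique : Unique elems
open Subset public

∣_∣ : ∀ {r} → Subset r → ℕ
∣ S ∣ = length (elems S)

HasZeroSumSubset : ∀ {r} → ℕ → Subset r → Set
HasZeroSumSubset {r} k S =
  ∃[ T ] (elems T ⊆ elems S × ∣ T ∣ ≡ k × ΣG (elems T) ≡ 0G)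

HarborthProp : ℕ → ℕ → ℕ → Set
HarborthProp k r t = (S : Subset r) → ∣ S ∣ ≥ t → HasZeroSumSubset k S

IsHarborthConstant : ℕ → ℕ → ℕ → Set
IsHarborthConstant k r t =
  1 ≤ t × HarborthProp k r t × (∀ s → 1 ≤ s → s < t → ¬ HarborthProp k r s)

{-# OPTIONS --safe #-}
-- A set A ⊆ C₂^r with no four distinct elements summing to zero (a Sidon set) shows
-- g⁴(C₂^r) > |A|. If A ⊆ C₂^m and B ⊆ C₂^n are Sidon sets containing 0, then so is their wedge
-- A × {0} ∪ {0} × B ⊆ C₂^(m+n), of size |A| + |B| − 1: comparing the two coordinates of a zero-sum
-- quadruple yields a pairing of its terms in each coordinate, and points on the axes cannot realise
-- two different pairings without a repetition. Wedging an explicit 18-element Sidon set in C₂^8 onto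
-- explicit Sidon sets in dimensions below 8 gives Sidon sets of size r + ⌊r/2⌋ + ⌊(r−4)/3⌋ at least.
module Submission where

open import Defs
open import Data.Nat using (ℕ; _≤_)
open import Data.Integer using (ℤ; +_; _+_; _-_; _/_)

import Data.Nat as ℕ
open import Data.Nat using (suc; _<_)
open import Data.Nat.Divisibility using (divides)
open import Data.Nat.DivMod using (+-distrib-/-∣ˡ; /-monoˡ-≤)
import Data.Nat.Properties as ℕₚ
open import Data.Nat.Solver using (module +-*-Solver)
import Data.Integer as ℤ
import Data.Integer.Properties as ℤₚ
open import Data.Integer.DivMod using (div-pos-is-/ℕ)
open import Data.Bool using (false)
open import Data.Bool.Properties using (xor-assoc; xor-comm; xor-identityˡ; xor-identityʳ; xor-same)
import Data.Bool.Properties as Boolₚ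
open import Data.Vec using ([]; _∷_; _++_)
open import Data.Vec.Properties
  using (zipWith-assoc; zipWith-comm; zipWith-identityˡ; zipWith-identityʳ; zipWith-++; ++-injectiveˡ; ++-injectiveʳ)
import Data.Vec.Properties as Vecₚ
open import Data.List using (List; []; _∷_; map; length)
import Data.List as List
open import Data.List.Properties using (length-++; length-map)
open import Data.List.Membership.Propositional using (_∈_)
open import Data.List.Membership.Propositional.Properties using (∈-map⁻; ∈-++⁻)
open import Data.List.Membership.DecPropositional using (_∈?_)
open import Data.List.Relation.Unary.Any using (here; there)
open import Data.List.Relation.Unary.All as All using (All; all?)
import Data.List.Relation.Unary.All.Properties as Allₚ
open import Data.List.Relation.Unary.AllPairs using (_∷_)
open import Data.List.Relation.Unary.Unique.Propositional using (Unique)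
import Data.List.Relation.Unary.Unique.Propositional.Properties as Uniqueₚ
open import Data.List.Relation.Unary.Unique.DecPropositional using (unique?)
open import Data.List.Relation.Binary.Permutation.Propositional
  using (_↭_; ↭-refl; ↭-prep; ↭-swap; ↭-trans; ↭-sym; ↭⇒↭ₛ)
open import Data.List.Relation.Binary.Permutation.Propositional.Properties using (shift)
open import Data.List.Relation.Binary.Permutation.Setoid.Properties using (foldr-commMonoid)
open import Data.Sum using (_⊎_; inj₁; inj₂; [_,_]′; map₂)
import Data.Sum as Sum
open import Data.Product using (_×_; _,_; proj₁; proj₂; uncurry)
open import Data.Empty using (⊥-elim)
open import Function using (_∘_)
open import Algebra.Structures using (IsCommutativeMonoid)
open import Relation.Binary.PropositionalEquality
  using (_≡_; refl; sym; trans; cong; cong₂; subst; setoid; module ≡-Reasoning)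
open import Relation.Binary.PropositionalEquality.Algebra using (isMagma)
open import Relation.Nullary using (¬_; Dec; yes; no)
open import Relation.Nullary.Decidable using (True; toWitness; _→-dec_; _⊎-dec_)

+G-assoc : ∀ {r} (x y z : C₂^ r) → (x +G y) +G z ≡ x +G (y +G z)
+G-assoc = zipWith-assoc xor-assoc

+G-comm : ∀ {r} (x y : C₂^ r) → x +G y ≡ y +G x
+G-comm = zipWith-comm xor-comm

+G-identityˡ : ∀ {r} (x : C₂^ r) → 0G +G x ≡ x
+G-identityˡ = zipWith-identityˡ xor-identityˡ

+G-identityʳ : ∀ {r} (x : C₂^ r) → x +G 0G ≡ x
+G-identityʳ = zipWith-identityʳ xor-identityʳ

+G-self : ∀ {r} (x : C₂^ r) → x +G x ≡ 0G
+G-self []      = refl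
+G-self (a ∷ x) = cong₂ _∷_ (xor-same a) (+G-self x)

+G-isCommutativeMonoid : ∀ {r} → IsCommutativeMonoid _≡_ (_+G_ {r}) 0G
+G-isCommutativeMonoid = record
  { isMonoid = record
    { isSemigroup = record { isMagma = isMagma _+G_ ; assoc = +G-assoc }
    ; identity    = +G-identityˡ , +G-identityʳ
    }
  ; comm = +G-comm
  }

+G-cancelˡ : ∀ {r} (x y : C₂^ r) → x +G (x +G y) ≡ y
+G-cancelˡ x y = begin
  x +G (x +G y) ≡⟨ +G-assoc x x y ⟨
  (x +G x) +G y ≡⟨ cong (_+G y) (+G-self x) ⟩
  0G +G y       ≡⟨ +G-identityˡ y ⟩
  y             ∎
  where open ≡-Reasoning

+G≡0G⇒≡ : ∀ {r} {x y : C₂^ r} → x +G y ≡ 0G → x ≡ y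
+G≡0G⇒≡ {x = x} {y} x+y≡0 = begin
  x              ≡⟨ +G-identityʳ x ⟨
  x +G 0G        ≡⟨ cong (x +G_) x+y≡0 ⟨
  x +G (x +G y)  ≡⟨ +G-cancelˡ x y ⟩
  y              ∎
  where open ≡-Reasoning

ΣG-↭ : ∀ {r} {xs ys : List (C₂^ r)} → xs ↭ ys → ΣG xs ≡ ΣG ys
ΣG-↭ xs↭ys = foldr-commMonoid (setoid _) +G-isCommutativeMonoid (↭⇒↭ₛ xs↭ys)

0G-++ : ∀ m {n} → 0G {m ℕ.+ n} ≡ 0G {m} ++ 0G {n}
0G-++ ℕ.zero  = refl
0G-++ (suc m) = cong (false ∷_) (0G-++ m)

++≡0G⇒ : ∀ {m n} {p : C₂^ m} {q : C₂^ n} → p ++ q ≡ 0G → p ≡ 0G × q ≡ 0G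
++≡0G⇒ {m} {n} {p} {q} p++q≡0 = ++-injectiveˡ p 0G eq , ++-injectiveʳ p 0G eq
  where
  eq : p ++ q ≡ 0G {m} ++ 0G {n}
  eq = trans p++q≡0 (0G-++ m)

ΣG-map-++ : ∀ {m n} (pqs : List (C₂^ m × C₂^ n)) →
  ΣG (map (uncurry _++_) pqs) ≡ ΣG (map proj₁ pqs) ++ ΣG (map proj₂ pqs)
ΣG-map-++ {m} []          = 0G-++ m
ΣG-map-++ ((p , q) ∷ pqs) = begin
  (p ++ q) +G ΣG (map (uncurry _++_) pqs)                 ≡⟨ cong ((p ++ q) +G_) (ΣG-map-++ pqs) ⟩
  (p ++ q) +G (ΣG (map proj₁ pqs) ++ ΣG (map proj₂ pqs))  ≡⟨ zipWith-++ _ p q _ _ ⟩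
  (p +G ΣG (map proj₁ pqs)) ++ (q +G ΣG (map proj₂ pqs))  ∎
  where open ≡-Reasoning

-- Since a + b = c + d iff a + b + c + d = 0 in C₂^r, this is the usual Sidon condition.
IsSidon : ∀ {r} → List (C₂^ r) → Set
IsSidon L = ∀ {a b c d} → a ∈ L → b ∈ L → c ∈ L → d ∈ L →
  ΣG (a ∷ b ∷ c ∷ d ∷ []) ≡ 0G → a ≡ b ⊎ a ≡ c ⊎ a ≡ d

data Pairing {A : Set} (a b c d : A) : Set where
  ab∣cd : a ≡ b → c ≡ d → Pairing a b c d
  ac∣bd : a ≡ c → b ≡ d → Pairing a b c d
  ad∣bc : a ≡ d → b ≡ c → Pairing a b c d

ΣG≡0G-pair : ∀ {r} {a b c d : C₂^ r} → a ≡ b → ΣG (a ∷ b ∷ c ∷ d ∷ []) ≡ 0G → c ≡ d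
ΣG≡0G-pair {a = a} {c = c} {d} refl s =
  trans (+G≡0G⇒≡ {y = ΣG (d ∷ [])} (trans (sym (+G-cancelˡ a (ΣG (c ∷ d ∷ [])))) s)) (+G-identityʳ d)

IsSidon⇒Pairing : ∀ {r} {L : List (C₂^ r)} → IsSidon L → ∀ {a b c d} →
  a ∈ L → b ∈ L → c ∈ L → d ∈ L → ΣG (a ∷ b ∷ c ∷ d ∷ []) ≡ 0G → Pairing a b c d
IsSidon⇒Pairing sidon {a} {b} {c} {d} a∈ b∈ c∈ d∈ s with sidon a∈ b∈ c∈ d∈ s
... | inj₁ a≡b        = ab∣cd a≡b (ΣG≡0G-pair a≡b s)
... | inj₂ (inj₁ a≡c) = ac∣bd a≡c (ΣG≡0G-pair a≡c (trans (ΣG-↭ acbd↭abcd) s))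
  where
  acbd↭abcd : a ∷ c ∷ b ∷ d ∷ [] ↭ a ∷ b ∷ c ∷ d ∷ []
  acbd↭abcd = ↭-prep a (↭-swap c b ↭-refl)
... | inj₂ (inj₂ a≡d) = ad∣bc a≡d (ΣG≡0G-pair a≡d (trans (ΣG-↭ adbc↭abcd) s))
  where
  adbc↭abcd : a ∷ d ∷ b ∷ c ∷ [] ↭ a ∷ b ∷ c ∷ d ∷ []
  adbc↭abcd = ↭-prep a (↭-trans (↭-swap d b ↭-refl) (↭-prep b (↭-swap d c ↭-refl)))

_≟_ : ∀ {r} → (x y : C₂^ r) → Dec (x ≡ y)
_≟_ = Vecₚ.≡-dec Boolₚ._≟_

-- The last term of a zero-sum quadruple is the sum of the other three, so a cubic check suffices.
SidonTriples : ∀ {r} → List (C₂^ r) → Set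
SidonTriples L = All (λ a → All (λ b → All (λ c → let d = ΣG (a ∷ b ∷ c ∷ []) in
  d ∈ L → a ≡ b ⊎ a ≡ c ⊎ a ≡ d) L) L) L

sidonTriples? : ∀ {r} (L : List (C₂^ r)) → Dec (SidonTriples L)
sidonTriples? L = all? (λ a → all? (λ b → all? (λ c → let d = ΣG (a ∷ b ∷ c ∷ []) in
  (_∈?_ _≟_ d L) →-dec (a ≟ b ⊎-dec a ≟ c ⊎-dec a ≟ d)) L) L) L

SidonTriples⇒IsSidon : ∀ {r} {L : List (C₂^ r)} → SidonTriples L → IsSidon L
SidonTriples⇒IsSidon {L = L} triples {a} {b} {c} {d} a∈ b∈ c∈ d∈ s =
  subst (λ x → a ≡ b ⊎ a ≡ c ⊎ a ≡ x) (sym d≡a+b+c)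
    (All.lookup (All.lookup (All.lookup triples a∈) b∈) c∈ (subst (_∈ L) d≡a+b+c d∈))
  where
  d≡a+b+c : d ≡ ΣG (a ∷ b ∷ c ∷ [])
  d≡a+b+c = +G≡0G⇒≡ {y = ΣG (a ∷ b ∷ c ∷ [])} (trans (ΣG-↭ (↭-sym (shift d (a ∷ b ∷ c ∷ []) []))) s)

OnAxis : ∀ {m n} → C₂^ m → C₂^ n → Set
OnAxis p q = p ≡ 0G ⊎ q ≡ 0G

-- x₁ agrees with x₂ in the first coordinate and with x₃ in the second; as every point lies on
-- an axis, x₁ agrees with one of them in both.
crossedPairings : ∀ {m n} {p₁ p₂ p₃ p₄ : C₂^ m} {q₁ q₂ q₃ q₄ : C₂^ n} →
  p₁ ≡ p₂ → p₃ ≡ p₄ → q₁ ≡ q₃ → q₂ ≡ q₄ →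
  OnAxis p₁ q₁ → OnAxis p₂ q₂ → OnAxis p₃ q₃ → OnAxis p₄ q₄ →
  p₁ ++ q₁ ≡ p₂ ++ q₂ ⊎ p₁ ++ q₁ ≡ p₃ ++ q₃
crossedPairings refl refl refl refl (inj₁ refl) _ (inj₁ refl) _ = inj₂ refl
crossedPairings refl refl refl refl (inj₂ refl) (inj₂ refl) _ _ = inj₁ refl
crossedPairings refl refl refl refl (inj₁ refl) _ (inj₂ refl) (inj₁ refl) = inj₂ refl
crossedPairings refl refl refl refl (inj₁ refl) _ (inj₂ refl) (inj₂ refl) = inj₁ refl
crossedPairings refl refl refl refl (inj₂ refl) (inj₁ refl) _ (inj₁ refl) = inj₂ refl
crossedPairings refl refl refl refl (inj₂ refl) (inj₁ refl) _ (inj₂ refl) = inj₁ refl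

pairingsOnAxes : ∀ {m n} {p₁ p₂ p₃ p₄ : C₂^ m} {q₁ q₂ q₃ q₄ : C₂^ n} →
  OnAxis p₁ q₁ → OnAxis p₂ q₂ → OnAxis p₃ q₃ → OnAxis p₄ q₄ →
  Pairing p₁ p₂ p₃ p₄ → Pairing q₁ q₂ q₃ q₄ →
  p₁ ++ q₁ ≡ p₂ ++ q₂ ⊎ p₁ ++ q₁ ≡ p₃ ++ q₃ ⊎ p₁ ++ q₁ ≡ p₄ ++ q₄
pairingsOnAxes _  _  _  _  (ab∣cd e _)  (ab∣cd f _)  = inj₁ (cong₂ _++_ e f)
pairingsOnAxes _  _  _  _  (ac∣bd e _)  (ac∣bd f _)  = inj₂ (inj₁ (cong₂ _++_ e f))
pairingsOnAxes _  _  _  _  (ad∣bc e _)  (ad∣bc f _)  = inj₂ (inj₂ (cong₂ _++_ e f))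
pairingsOnAxes t₁ t₂ t₃ t₄ (ab∣cd e e′) (ac∣bd f f′) = map₂ inj₁ (crossedPairings e e′ f f′ t₁ t₂ t₃ t₄)
pairingsOnAxes t₁ t₂ t₃ t₄ (ab∣cd e e′) (ad∣bc f f′) = map₂ inj₂ (crossedPairings e (sym e′) f f′ t₁ t₂ t₄ t₃)
pairingsOnAxes t₁ t₂ t₃ t₄ (ac∣bd e e′) (ab∣cd f f′) = [ inj₂ ∘ inj₁ , inj₁ ]′ (crossedPairings e e′ f f′ t₁ t₃ t₂ t₄)
pairingsOnAxes t₁ t₂ t₃ t₄ (ac∣bd e e′) (ad∣bc f f′) = inj₂ (crossedPairings e (sym e′) f (sym f′) t₁ t₃ t₄ t₂)
pairingsOnAxes t₁ t₂ t₃ t₄ (ad∣bc e e′) (ab∣cd f f′) = [ inj₂ ∘ inj₂ , inj₁ ]′ (crossedPairings e e′ f (sym f′) t₁ t₄ t₂ t₃)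
pairingsOnAxes t₁ t₂ t₃ t₄ (ad∣bc e e′) (ac∣bd f f′) = inj₂ (Sum.swap (crossedPairings e (sym e′) f (sym f′) t₁ t₄ t₃ t₂))

wedge : ∀ {m n} → List (C₂^ m) → List (C₂^ n) → List (C₂^ (m ℕ.+ n))
wedge B S = map (_++ 0G) B List.++ map (0G ++_) S

data OnAxes {m n} (P : List (C₂^ m)) (Q : List (C₂^ n)) : C₂^ (m ℕ.+ n) → Set where
  onAxes : ∀ {p q} → p ∈ P → q ∈ Q → OnAxis p q → OnAxes P Q (p ++ q)

∈-wedge⁻ : ∀ {m n} (B : List (C₂^ m)) (S : List (C₂^ n)) {x} →
  x ∈ 0G ∷ wedge B S → OnAxes (0G ∷ B) (0G ∷ S) x
∈-wedge⁻ {m} _ _ (here refl) = subst (OnAxes _ _) (sym (0G-++ m)) (onAxes (here refl) (here refl) (inj₁ refl))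
∈-wedge⁻ B _ (there x∈) with ∈-++⁻ (map (_++ 0G) B) x∈
... | inj₁ x∈B with ∈-map⁻ (_++ 0G) x∈B
...   | _ , b∈ , refl = onAxes (there b∈) (here refl) (inj₂ refl)
∈-wedge⁻ _ _ (there x∈) | inj₂ x∈S with ∈-map⁻ (0G ++_) x∈S
...   | _ , s∈ , refl = onAxes (here refl) (there s∈) (inj₁ refl)

wedge-isSidon : ∀ {m n} {B : List (C₂^ m)} {S : List (C₂^ n)} →
  IsSidon (0G ∷ B) → IsSidon (0G ∷ S) → IsSidon (0G ∷ wedge B S)
wedge-isSidon {B = B} {S} sidonB sidonS x₁∈ x₂∈ x₃∈ x₄∈ s
  with ∈-wedge⁻ B S x₁∈ | ∈-wedge⁻ B S x₂∈ | ∈-wedge⁻ B S x₃∈ | ∈-wedge⁻ B S x₄∈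
... | onAxes {p₁} {q₁} p₁∈ q₁∈ t₁ | onAxes {p₂} {q₂} p₂∈ q₂∈ t₂
    | onAxes {p₃} {q₃} p₃∈ q₃∈ t₃ | onAxes {p₄} {q₄} p₄∈ q₄∈ t₄ =
  pairingsOnAxes t₁ t₂ t₃ t₄
    (IsSidon⇒Pairing sidonB p₁∈ p₂∈ p₃∈ p₄∈ (proj₁ sums≡0G))
    (IsSidon⇒Pairing sidonS q₁∈ q₂∈ q₃∈ q₄∈ (proj₂ sums≡0G))
  where
  sums≡0G : ΣG (p₁ ∷ p₂ ∷ p₃ ∷ p₄ ∷ []) ≡ 0G × ΣG (q₁ ∷ q₂ ∷ q₃ ∷ q₄ ∷ []) ≡ 0G
  sums≡0G = ++≡0G⇒ (trans (sym (ΣG-map-++ ((p₁ , q₁) ∷ (p₂ , q₂) ∷ (p₃ , q₃) ∷ (p₄ , q₄) ∷ []))) s)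

wedge-unique : ∀ {m n} {B : List (C₂^ m)} {S : List (C₂^ n)} →
  Unique (0G ∷ B) → Unique (0G ∷ S) → Unique (0G ∷ wedge B S)
wedge-unique {m} {B = B} {S} (0∉B ∷ uniqueB) (0∉S ∷ uniqueS) =
  Allₚ.++⁺ (Allₚ.map⁺ (All.map (λ 0≢b 0≡b++0 → 0≢b (sym (proj₁ (++≡0G⇒ (sym 0≡b++0))))) 0∉B))
           (Allₚ.map⁺ (All.map (λ 0≢s 0≡0++s → 0≢s (sym (proj₂ (++≡0G⇒ (sym 0≡0++s))))) 0∉S))
  ∷ Uniqueₚ.++⁺ (Uniqueₚ.map⁺ (λ {b} {b′} → ++-injectiveˡ b b′) uniqueB)
                (Uniqueₚ.map⁺ (++-injectiveʳ 0G 0G) uniqueS)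
                disjoint
  where
  disjoint : ∀ {x} → ¬ (x ∈ map (_++ 0G) B × x ∈ map (0G ++_) S)
  disjoint (x∈B , x∈S) with ∈-map⁻ (_++ 0G) x∈B | ∈-map⁻ (0G ++_) x∈S
  ... | b , b∈ , refl | _ , _ , b++0≡0++s = All.lookup 0∉B b∈ (sym (++-injectiveˡ b 0G b++0≡0++s))

length-wedge : ∀ {m n} (B : List (C₂^ m)) (S : List (C₂^ n)) → length (wedge B S) ≡ length B ℕ.+ length S
length-wedge B S = trans (length-++ (map (_++ 0G) B)) (cong₂ ℕ._+_ (length-map _ B) (length-map _ S))

record PointedSidonSet (r : ℕ) : Set where
  field
    nonzero : List (C₂^ r)
    distinct : Unique (0G ∷ nonzero)
    sidon    : IsSidon (0G ∷ nonzero)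
open PointedSidonSet

toSubset : ∀ {r} → PointedSidonSet r → Subset r
toSubset X = mkSubset (0G ∷ nonzero X) (distinct X)

_∨_ : ∀ {m n} → PointedSidonSet m → PointedSidonSet n → PointedSidonSet (m ℕ.+ n)
X ∨ Y = record
  { nonzero  = wedge (nonzero X) (nonzero Y)
  ; distinct = wedge-unique (distinct X) (distinct Y)
  ; sidon    = wedge-isSidon (sidon X) (sidon Y)
  }

bits : ∀ r → ℕ → C₂^ r
bits ℕ.zero  _ = []
bits (suc r) n = (n ℕ.% 2 ℕ.≡ᵇ 1) ∷ bits r (n ℕ./ 2)

fromCodes : ∀ r (codes : List ℕ) → let L = 0G ∷ map (bits r) codes in
  {True (unique? _≟_ L)} → {True (sidonTriples? L)} → PointedSidonSet r
fromCodes r codes {distinct} {triples} = record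
  { nonzero  = map (bits r) codes
  ; distinct = toWitness distinct
  ; sidon    = SidonTriples⇒IsSidon (toWitness triples)
  }

sidonSet₈ : PointedSidonSet 8
sidonSet₈ = fromCodes 8
  (182 ∷ 54 ∷ 56 ∷ 187 ∷ 112 ∷ 111 ∷ 2 ∷ 248 ∷ 49 ∷ 148 ∷ 16 ∷ 168 ∷ 207 ∷ 242 ∷ 48 ∷ 21 ∷ 227 ∷ [])

sidonSet : ∀ r → PointedSidonSet r
sidonSet 0 = fromCodes 0 []
sidonSet 1 = fromCodes 1 (1 ∷ [])
sidonSet 2 = fromCodes 2 (1 ∷ 3 ∷ [])
sidonSet 3 = fromCodes 3 (6 ∷ 5 ∷ 1 ∷ [])
sidonSet 4 = fromCodes 4 (13 ∷ 10 ∷ 4 ∷ 11 ∷ 8 ∷ [])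
sidonSet 5 = fromCodes 5 (2 ∷ 18 ∷ 12 ∷ 17 ∷ 21 ∷ 10 ∷ [])
sidonSet 6 = fromCodes 6 (46 ∷ 39 ∷ 34 ∷ 35 ∷ 18 ∷ 21 ∷ 44 ∷ 63 ∷ [])
sidonSet 7 = fromCodes 7 (68 ∷ 93 ∷ 40 ∷ 1 ∷ 37 ∷ 52 ∷ 102 ∷ 114 ∷ 101 ∷ 18 ∷ 89 ∷ [])
sidonSet (suc (suc (suc (suc (suc (suc (suc (suc r)))))))) = sidonSet₈ ∨ sidonSet r

bound : ℕ → ℕ
bound r = r ℕ.+ r ℕ./ 2 ℕ.+ (r ℕ.∸ 4) ℕ./ 3

bound-step : ∀ r → bound (8 ℕ.+ r) ≤ 17 ℕ.+ bound r
bound-step r = begin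
  bound (8 ℕ.+ r)                                ≤⟨ ℕₚ.+-mono-≤ (ℕₚ.≤-reflexive (cong (8 ℕ.+ r ℕ.+_) half)) third ⟩
  8 ℕ.+ r ℕ.+ (4 ℕ.+ r ℕ./ 2) ℕ.+ (3 ℕ.+ c)     ≡⟨ regroup r (r ℕ./ 2) c ⟩
  15 ℕ.+ bound r                                 ≤⟨ ℕₚ.+-monoˡ-≤ (bound r) (ℕₚ.m≤m+n 15 2) ⟩
  17 ℕ.+ bound r                                 ∎
  where
  open ℕₚ.≤-Reasoning
  c : ℕ
  c = (r ℕ.∸ 4) ℕ./ 3
  half : (8 ℕ.+ r) ℕ./ 2 ≡ 4 ℕ.+ r ℕ./ 2
  half = +-distrib-/-∣ˡ r {2} (divides 4 refl)
  third : (4 ℕ.+ r) ℕ./ 3 ≤ 3 ℕ.+ c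
  third = begin
    (4 ℕ.+ r) ℕ./ 3              ≤⟨ /-monoˡ-≤ 3 (ℕₚ.+-monoʳ-≤ 4 (ℕₚ.≤-trans (ℕₚ.m≤n+m∸n r 4) (ℕₚ.n≤1+n _))) ⟩
    (9 ℕ.+ (r ℕ.∸ 4)) ℕ./ 3      ≡⟨ +-distrib-/-∣ˡ (r ℕ.∸ 4) {3} (divides 3 refl) ⟩
    3 ℕ.+ c                      ∎
  open +-*-Solver
  regroup : ∀ r h c → 8 ℕ.+ r ℕ.+ (4 ℕ.+ h) ℕ.+ (3 ℕ.+ c) ≡ 15 ℕ.+ (r ℕ.+ h ℕ.+ c)
  regroup = solve 3 (λ r h c → con 8 :+ r :+ (con 4 :+ h) :+ (con 3 :+ c) := con 15 :+ (r :+ h :+ c)) refl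

sidonSet-size : ∀ r → bound r ≤ ∣ toSubset (sidonSet r) ∣
sidonSet-size 0 = ℕₚ.≤ᵇ⇒≤ _ _ _
sidonSet-size 1 = ℕₚ.≤ᵇ⇒≤ _ _ _
sidonSet-size 2 = ℕₚ.≤ᵇ⇒≤ _ _ _
sidonSet-size 3 = ℕₚ.≤ᵇ⇒≤ _ _ _
sidonSet-size 4 = ℕₚ.≤ᵇ⇒≤ _ _ _
sidonSet-size 5 = ℕₚ.≤ᵇ⇒≤ _ _ _
sidonSet-size 6 = ℕₚ.≤ᵇ⇒≤ _ _ _
sidonSet-size 7 = ℕₚ.≤ᵇ⇒≤ _ _ _
sidonSet-size r@(suc (suc (suc (suc (suc (suc (suc (suc r′)))))))) = begin
  bound r                                   ≤⟨ bound-step r′ ⟩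
  17 ℕ.+ bound r′                           ≤⟨ ℕₚ.+-monoʳ-≤ 17 (sidonSet-size r′) ⟩
  17 ℕ.+ ∣ toSubset (sidonSet r′) ∣         ≡⟨ cong suc (length-wedge (nonzero sidonSet₈) (nonzero (sidonSet r′))) ⟨
  ∣ toSubset (sidonSet r) ∣                 ∎
  where open ℕₚ.≤-Reasoning

IsSidon⇒¬HasZeroSumSubset4 : ∀ {r} (S : Subset r) → IsSidon (elems S) → ¬ HasZeroSumSubset 4 S
IsSidon⇒¬HasZeroSumSubset4 S sidon
  (mkSubset (a ∷ b ∷ c ∷ d ∷ []) ((a≢b All.∷ a≢c All.∷ a≢d All.∷ All.[]) ∷ _) , T⊆S , refl , s)
  with sidon (T⊆S (here refl)) (T⊆S (there (here refl))) (T⊆S (there (there (here refl))))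
             (T⊆S (there (there (there (here refl))))) s
... | inj₁ a≡b        = a≢b a≡b
... | inj₂ (inj₁ a≡c) = a≢c a≡c
... | inj₂ (inj₂ a≡d) = a≢d a≡d
IsSidon⇒¬HasZeroSumSubset4 S sidon (mkSubset [] _ , _ , () , _)
IsSidon⇒¬HasZeroSumSubset4 S sidon (mkSubset (_ ∷ []) _ , _ , () , _)
IsSidon⇒¬HasZeroSumSubset4 S sidon (mkSubset (_ ∷ _ ∷ []) _ , _ , () , _)
IsSidon⇒¬HasZeroSumSubset4 S sidon (mkSubset (_ ∷ _ ∷ _ ∷ []) _ , _ , () , _)
IsSidon⇒¬HasZeroSumSubset4 S sidon (mkSubset (_ ∷ _ ∷ _ ∷ _ ∷ _ ∷ _) _ , _ , () , _)

HarborthProp⇒size< : ∀ {k r t} → HarborthProp k r t → (S : Subset r) → ¬ HasZeroSumSubset k S → ∣ S ∣ < t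
HarborthProp⇒size< {t = t} harborth S noZeroSum with t ℕ.≤? ∣ S ∣
... | yes t≤∣S∣ = ⊥-elim (noZeroSum (harborth S t≤∣S∣))
... | no  t≰∣S∣ = ℕₚ.≰⇒> t≰∣S∣

[r-4]/3≤[r∸4]/3 : ∀ r → (+ r - + 4) / + 3 ℤ.≤ + ((r ℕ.∸ 4) ℕ./ 3)
[r-4]/3≤[r∸4]/3 0 = ℤ.-≤+
[r-4]/3≤[r∸4]/3 1 = ℤ.-≤+
[r-4]/3≤[r∸4]/3 2 = ℤ.-≤+
[r-4]/3≤[r∸4]/3 3 = ℤ.-≤+
[r-4]/3≤[r∸4]/3 (suc (suc (suc (suc k)))) = ℤₚ.≤-reflexive (div-pos-is-/ℕ (+ k) 3)

proposition3p6 : (r : ℕ) → 1 ≤ r → (g : ℕ) → IsHarborthConstant 4 r g →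
    (+ r) + (+ r / + 2) + ((+ r - + 4) / + 3) + + 1 Data.Integer.≤ + g
proposition3p6 r _ g (_ , harborth , _) = begin
  + r + + r / + 2 + (+ r - + 4) / + 3 + + 1       ≡⟨ cong (λ h → + r + h + (+ r - + 4) / + 3 + + 1) (div-pos-is-/ℕ (+ r) 2) ⟩
  + r + + (r ℕ./ 2) + (+ r - + 4) / + 3 + + 1     ≤⟨ ℤₚ.+-monoˡ-≤ (+ 1) (ℤₚ.+-monoʳ-≤ (+ r + + (r ℕ./ 2)) ([r-4]/3≤[r∸4]/3 r)) ⟩
  + (bound r ℕ.+ 1)                               ≤⟨ ℤ.+≤+ (subst (_≤ g) (ℕₚ.+-comm 1 (bound r)) bound<g) ⟩
  + g                                             ∎
  where
  open ℤₚ.≤-Reasoning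
  X : Subset r
  X = toSubset (sidonSet r)
  bound<g : bound r < g
  bound<g = ℕₚ.≤-<-trans (sidonSet-size r)
    (HarborthProp⇒size< harborth X (IsSidon⇒¬HasZeroSumSubset4 X (sidon (sidonSet r))))
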